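{- Let $\delta>0$ be a constant and $p=1/2$. Then asymptotically almost surely (i.e. with probability tending to $1$ as $n\to\infty$) the random graph $G(n,1/2)$ satisfies $$w(G(n,1/2)) \le (1+\delta)\log_2 n + 1 .$$
   Context: $G(n,p)$ is the random graph on $n$ labeled vertices in which each of the $\binom n2$ possible edges is present independently with probability $p$. All graphs are simple. A graph homomorphism $\phi:G\to H$ is a map $V(G)\to V(H)$ sending edges to edges; $\mathrm{Hom}(G,H)$ denotes the set of homomorphisms. For $d\ge 0$, $T^d$ is the infinite rooted tree in which the root has $d$ children and every other vertex also has exactly $d$ children. A map $\varphi\in\mathrm{Hom}(T^d,G)$ is called cold if there is a vertex $a$ of $G$ such that for every $k$ there is no $\psi\in\mathrm{Hom}(T^d,G)$ that agrees with $\varphi$ on all vertices at distance $k$ from the root $r$ and has $\psi(r)=a$. A graph $G$ is $d$-warm if $\mathrm{Hom}(T^{d-2},G)$ contains no cold maps, and the warmth $w(G)$ is the largest $d$ for which $G$ is $d$-warm.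
   Formalization: The constant δ ranges only over the positive rationals. -}

module Defs where

open import Data.Nat using (ℕ; zero; suc; _+_; _*_; _∸_; _^_; _≤_)
open import Data.Nat.Combinatorics using (_C_)
open import Data.Fin using (Fin) renaming (_<_ to _<ᶠ_)
open import Data.Bool using (Bool; true)
open import Data.List using (List; []; _∷_; length)
open import Data.List.Relation.Unary.All using (All)
open import Data.List.Relation.Unary.AllPairs using (AllPairs)
open import Data.Product using (Σ; ∃; ∃-syntax; _×_)
open import Data.Sum using (_⊎_)
open import Relation.Nullary using (¬_)
open import Relation.Binary.PropositionalEquality using (_≡_; _≢_)

-- A labelled simple graph on vertex set Fin n is encoded by its upper
-- triangle: the value  G i j  for  i < j  says whether {i,j} is an edge.
-- Values with i ≥ j are ignored (see _≈G_ below).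
Graph : ℕ → Set
Graph n = Fin n → Fin n → Bool

Adj : ∀ {n} → Graph n → Fin n → Fin n → Set
Adj G i j = (i <ᶠ j × G i j ≡ true) ⊎ (j <ᶠ i × G j i ≡ true)

DifferentGraphs : ∀ {n} → Graph n → Graph n → Set
DifferentGraphs {n} G H = ∃[ i ] ∃[ j ] (i <ᶠ j × G i j ≢ H i j)

-- The infinite rooted tree T^d: vertices are finite words over Fin d,
-- the root is [], and the children of w are  c ∷ w  (c : Fin d).
-- Depth (distance from the root) of w is  length w.
TVertex : ℕ → Set
TVertex d = List (Fin d)

IsHom : ∀ {n} (d : ℕ) → Graph n → (TVertex d → Fin n) → Set
IsHom d G φ = ∀ (w : TVertex d) (c : Fin d) → Adj G (φ w) (φ (c ∷ w))

IsCold : ∀ {n} (d : ℕ) → Graph n → (TVertex d → Fin n) → Set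
IsCold {n} d G φ =
  ∃[ a ] ∀ (k : ℕ) →
    ¬ (Σ (TVertex d → Fin n) λ ψ →
         IsHom d G ψ
         × (∀ (w : TVertex d) → length w ≡ k → ψ w ≡ φ w)
         × ψ [] ≡ a)

-- G is d-warm: Hom(T^{d-2}, G) contains no cold maps
-- (for d ≤ 1 we use T^0, following natural-number truncation d ∸ 2)
IsWarm : ∀ {n} → ℕ → Graph n → Set
IsWarm {n} d G = ∀ (φ : TVertex (d ∸ 2) → Fin n) → IsHom (d ∸ 2) G φ → ¬ IsCold (d ∸ 2) G φ

-- w(G) ≤ (1 + a/b) log₂ n + 1, stated as "every d for which G is d-warm
-- satisfies d ≤ (1 + a/b) log₂ n + 1", the latter written in integer form
-- 2^((d-1)·b) ≤ n^(a+b)  (equivalent for b ≥ 1, n ≥ 1).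
WarmthBound : ∀ {n} → ℕ → ℕ → Graph n → Set
WarmthBound {n} a b G = ∀ (d : ℕ) → IsWarm d G → 2 ^ ((d ∸ 1) * b) ≤ n ^ (a + b)

-- Number of labelled graphs on n vertices: 2^(n choose 2); under
-- G(n,1/2) every one of them has probability 2^-(n choose 2).
numGraphs : ℕ → ℕ
numGraphs n = 2 ^ (n C 2)

-- "P holds in G(n,1/2) with probability ≥ 1 - 1/q":
-- there is a list of pairwise different graphs, all satisfying P,
-- whose number L satisfies  q · (2^(n choose 2) - L) ≤ 2^(n choose 2).
ProbAtLeast1-1/ : (q n : ℕ) → (Graph n → Set) → Set
ProbAtLeast1-1/ q n P =
  Σ (List (Graph n)) λ Gs →
    AllPairs DifferentGraphs Gs × All P Gs
    × q * (numGraphs n ∸ length Gs) ≤ numGraphs n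

-- A map T^d → G built from a rigid frame is cold.  A frame is a set of core vertices, each with
-- at most d children among its core neighbours, such that the only common neighbour of the
-- children of a core vertex is that vertex.  Unfolding the frame from a root gives a
-- homomorphism, and a homomorphism that agrees with it at depth k agrees with it at every
-- smaller depth, because children determine their parent; so it cannot move the root, and G is
-- not (d+2)-warm.
--
-- In G(n,1/2) take two disjoint sets of 8D vertices and let every core vertex choose as children
-- its first D neighbours on the other side.  This fails only if some core vertex has fewer than D
-- neighbours among its 8D candidates, or some other vertex is adjacent to all of its D children.
-- Each of these at most 16D(n+1) events has probability at most 2^-D, which is small for
-- D ≈ (1 + 1/(b+1)) log₂ n, and then w(G) ≤ D + 1.  Probabilities are counted exactly, as
-- numbers of assignments of the edge variables, by conditioning on one variable at a time.

module Submission where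

open import Defs
open import Data.Nat using (ℕ; suc; _≥_)
open import Data.Product using (∃-syntax)

open import Data.Bool using (Bool; true; false; if_then_else_; _∨_; not)
import Data.Bool.Properties as Bool
open import Data.Empty using (⊥; ⊥-elim)
open import Data.Fin using (Fin)
import Data.Fin as Fin
import Data.Fin.Properties as Fin
open import Data.List using (List; []; _∷_; _++_; length; map; filter; concat; concatMap; fromMaybe; allFin; tabulate)
open import Data.List.Properties using (length-++; filter-++; length-map; length-tabulate; length-filter; map-∘)
open import Data.List.Membership.Propositional using (_∈_; _∉_; find)
open import Data.List.Membership.Propositional.Properties
  using (∈-++⁻; ∈-++⁺ˡ; ∈-++⁺ʳ; ∈-map⁺; ∈-map⁻; ∈-allFin; ∈-tabulate⁺; ∈-tabulate⁻; ∈-filter⁺; ∈-filter⁻; ∈-concat⁺′; ∈-concatMap⁻)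
open import Data.List.Relation.Unary.Any using (here; there)
open import Data.List.Relation.Unary.All using (All; []; _∷_)
import Data.List.Relation.Unary.All as All
import Data.List.Relation.Unary.All.Properties as All
open import Data.List.Relation.Unary.AllPairs using (AllPairs; []; _∷_)
import Data.List.Relation.Unary.AllPairs as AllPairs
import Data.List.Relation.Unary.AllPairs.Properties as AllPairs
open import Data.List.Relation.Unary.Unique.Propositional using (Unique)
open import Data.List.Relation.Unary.Unique.Propositional.Properties using (Unique[x∷xs]⇒x∉xs)
import Data.List.Relation.Unary.Unique.Propositional.Properties as Unique
open import Data.Maybe using (Maybe; just; nothing)
open import Data.Nat using (zero; _+_; _*_; _∸_; _^_; _≤_; _<_; z≤n; s≤s)
open import Data.Nat.Combinatorics using (_C_; nC1≡n; nCk+nC[k+1]≡[n+1]C[k+1])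
open import Data.Nat.DivMod using (_/_; _%_; m≡m%n+[m/n]*n; m%n<n; m*n/n≡m; /-monoˡ-≤; m/n*n≤m)
open import Data.Nat.Properties
open import Algebra.Properties.CommutativeSemigroup +-commutativeSemigroup using (interchange)
open import Data.Nat.Tactic.RingSolver using (solve-∀)
open import Data.Product as Product using (_×_; _,_; proj₁; proj₂)
open import Data.Product.Properties using (≡-dec)
open import Data.Sum using (_⊎_; inj₁; inj₂)
open import Function using (_∘_)
open import Relation.Binary.Definitions using (DecidableEquality)
open import Relation.Binary.PropositionalEquality
open import Relation.Nullary using (¬_; ¬?; does; yes; no)
open import Relation.Nullary.Decidable using (dec-true; dec-false)

true≢false : true ≢ false
true≢false ()

2^-double : ∀ k → 2 ^ k + 2 ^ k ≡ 2 ^ suc k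
2^-double k = cong (2 ^ k +_) (sym (+-identityʳ (2 ^ k)))

^-distribʳ-* : ∀ m n k → (m * n) ^ k ≡ m ^ k * n ^ k
^-distribʳ-* m n zero    = refl
^-distribʳ-* m n (suc k) = trans (cong (m * n *_) (^-distribʳ-* m n k)) (shuffle m n (m ^ k) (n ^ k))
  where
  shuffle : ∀ a b c d → a * b * (c * d) ≡ a * c * (b * d)
  shuffle = solve-∀

2^D*4^[8D]*3^D≤6^[8D] : ∀ D → 2 ^ D * 4 ^ (8 * D) * 3 ^ D ≤ 6 ^ (8 * D)
2^D*4^[8D]*3^D≤6^[8D] D = begin
  2 ^ D * 4 ^ (8 * D) * 3 ^ D ≡⟨ cong (λ x → 2 ^ D * x * 3 ^ D) (sym (^-*-assoc 4 8 D)) ⟩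
  2 ^ D * (4 ^ 8) ^ D * 3 ^ D ≡⟨ cong (_* 3 ^ D) (sym (^-distribʳ-* 2 (4 ^ 8) D)) ⟩
  (2 * 4 ^ 8) ^ D * 3 ^ D     ≡⟨ sym (^-distribʳ-* (2 * 4 ^ 8) 3 D) ⟩
  (2 * 4 ^ 8 * 3) ^ D         ≤⟨ ^-monoˡ-≤ D (m≤m+n 393216 1286400) ⟩
  (6 ^ 8) ^ D                 ≡⟨ ^-*-assoc 6 8 D ⟩
  6 ^ (8 * D) ∎
  where open ≤-Reasoning

takeFirst : ∀ {A : Set} → ℕ → (A → Bool) → List A → List A
takeFirst zero    p xs       = []
takeFirst (suc D) p []       = []
takeFirst (suc D) p (x ∷ xs) = if p x then x ∷ takeFirst D p xs else takeFirst (suc D) p xs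

∈-takeFirst⁻ : ∀ {A : Set} D (p : A → Bool) xs {x} → x ∈ takeFirst D p xs → x ∈ xs × p x ≡ true
∈-takeFirst⁻ (suc D) p (y ∷ xs) x∈ with p y in py
... | true with x∈
...   | here refl = here refl , py
...   | there x∈′ = Product.map₁ there (∈-takeFirst⁻ D p xs x∈′)
∈-takeFirst⁻ (suc D) p (y ∷ xs) x∈ | false = Product.map₁ there (∈-takeFirst⁻ (suc D) p xs x∈)

-- Indices past the end denote the last element.
lookupClamped : ∀ {A : Set} → A → List A → ℕ → A
lookupClamped a []           i       = a
lookupClamped a (x ∷ [])     i       = x
lookupClamped a (x ∷ y ∷ xs) zero    = x
lookupClamped a (x ∷ y ∷ xs) (suc i) = lookupClamped a (y ∷ xs) i

lookupClamped-∈ : ∀ {A : Set} (a : A) xs i → 0 < length xs → lookupClamped a xs i ∈ xs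
lookupClamped-∈ a (x ∷ [])     i       _ = here refl
lookupClamped-∈ a (x ∷ y ∷ xs) zero    _ = here refl
lookupClamped-∈ a (x ∷ y ∷ xs) (suc i) _ = there (lookupClamped-∈ a (y ∷ xs) i (s≤s z≤n))

lookupClamped-surjective : ∀ {A : Set} (a : A) {x} xs → x ∈ xs →
                           ∃[ i ] i < length xs × lookupClamped a xs i ≡ x
lookupClamped-surjective a (x ∷ [])     (here refl) = 0 , s≤s z≤n , refl
lookupClamped-surjective a (x ∷ y ∷ xs) (here refl) = 0 , s≤s z≤n , refl
lookupClamped-surjective a (x ∷ y ∷ xs) (there x∈) =
  let i , i<len , eq = lookupClamped-surjective a (y ∷ xs) x∈ in suc i , s≤s i<len , eq

concatMap-unique : ∀ {A B : Set} (g : A → List B) {xs} → Unique xs → (∀ {x} → x ∈ xs → Unique (g x)) →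
                   (∀ {x y b} → x ∈ xs → y ∈ xs → b ∈ g x → b ∈ g y → x ≡ y) → Unique (concatMap g xs)
concatMap-unique g {[]}     _      _    _      = []
concatMap-unique g {x ∷ xs} unique each shared =
  Unique.++⁺ (each (here refl))
             (concatMap-unique g (AllPairs.tail unique) (each ∘ there) (λ x∈ y∈ → shared (there x∈) (there y∈)))
             λ (b∈gx , b∈rest) →
               let y , y∈xs , b∈gy = find (∈-concatMap⁻ g b∈rest)
                   x≡y = shared (here refl) (there y∈xs) b∈gx b∈gy
               in Unique[x∷xs]⇒x∉xs unique (subst (_∈ xs) (sym x≡y) y∈xs)

length-concatMap-≤ : ∀ {A B : Set} (g : A → List B) {m} xs → (∀ x → length (g x) ≤ m) →
                     length (concatMap g xs) ≤ length xs * m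
length-concatMap-≤ g []       _ = z≤n
length-concatMap-≤ g (x ∷ xs) bounded =
  ≤-trans (≤-reflexive (length-++ (g x))) (+-mono-≤ (bounded x) (length-concatMap-≤ g xs bounded))

-- Counting assignments of Boolean variables

module BooleanCube {V : Set} (_≟_ : DecidableEquality V) where

  Assignment : Set
  Assignment = V → Bool

  Event : Set
  Event = Assignment → Bool

  _[_≔_] : Assignment → V → Bool → Assignment
  (σ [ v ≔ b ]) u = if does (u ≟ v) then b else σ u

  update-same : ∀ σ v b → (σ [ v ≔ b ]) v ≡ b
  update-same σ v b rewrite dec-true (v ≟ v) refl = refl

  update-other : ∀ σ {u v} b → u ≢ v → (σ [ v ≔ b ]) u ≡ σ u
  update-other σ {u} {v} b u≢v rewrite dec-false (u ≟ v) u≢v = refl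

  -- The number of assignments that agree with σ outside vs and satisfy e.
  count : List V → Event → Assignment → ℕ
  count []       e σ = if e σ then 1 else 0
  count (v ∷ vs) e σ = count vs e (σ [ v ≔ true ]) + count vs e (σ [ v ≔ false ])

  count-≤ : ∀ vs e σ → count vs e σ ≤ 2 ^ length vs
  count-≤ []       e σ with e σ
  ... | true  = ≤-refl
  ... | false = z≤n
  count-≤ (v ∷ vs) e σ =
    ≤-trans (+-mono-≤ (count-≤ vs e _) (count-≤ vs e _)) (≤-reflexive (2^-double (length vs)))

  count-never : ∀ vs σ → count vs (λ _ → false) σ ≡ 0
  count-never []       σ = refl
  count-never (v ∷ vs) σ = cong₂ _+_ (count-never vs _) (count-never vs _)

  count-∨ : ∀ vs e e′ σ → count vs (λ τ → e τ ∨ e′ τ) σ ≤ count vs e σ + count vs e′ σ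
  count-∨ []       e e′ σ with e σ
  ... | true  = s≤s z≤n
  ... | false = ≤-refl
  count-∨ (v ∷ vs) e e′ σ =
    ≤-trans (+-mono-≤ (count-∨ vs e e′ _) (count-∨ vs e e′ _))
            (≤-reflexive (interchange (count vs e _) (count vs e′ _) (count vs e _) (count vs e′ _)))

  count-complement : ∀ vs e σ → count vs e σ + count vs (not ∘ e) σ ≡ 2 ^ length vs
  count-complement []       e σ with e σ
  ... | true  = refl
  ... | false = refl
  count-complement (v ∷ vs) e σ = begin
    (count vs e σ₁ + count vs e σ₀) + (count vs (not ∘ e) σ₁ + count vs (not ∘ e) σ₀)
      ≡⟨ interchange (count vs e σ₁) (count vs e σ₀) _ _ ⟩
    (count vs e σ₁ + count vs (not ∘ e) σ₁) + (count vs e σ₀ + count vs (not ∘ e) σ₀)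
      ≡⟨ cong₂ _+_ (count-complement vs e σ₁) (count-complement vs e σ₀) ⟩
    2 ^ length vs + 2 ^ length vs
      ≡⟨ 2^-double (length vs) ⟩
    2 ^ suc (length vs) ∎
    where
    open ≡-Reasoning
    σ₁ = σ [ v ≔ true ]
    σ₀ = σ [ v ≔ false ]

  AgreeOff : V → Assignment → Assignment → Set
  AgreeOff v σ τ = ∀ u → u ≢ v → σ u ≡ τ u

  Ignores : V → Event → Set
  Ignores v e = ∀ {σ τ} → AgreeOff v σ τ → e σ ≡ e τ

  AgreeOff-update : ∀ {v σ τ} w b → AgreeOff v σ τ → AgreeOff v (σ [ w ≔ b ]) (τ [ w ≔ b ])
  AgreeOff-update w b agree u u≢v with u ≟ w
  ... | yes _ = refl
  ... | no  _ = agree u u≢v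

  AgreeOff-flip : ∀ σ v → AgreeOff v (σ [ v ≔ true ]) (σ [ v ≔ false ])
  AgreeOff-flip σ v u u≢v = trans (update-other σ true u≢v) (sym (update-other σ false u≢v))

  count-ignores : ∀ {v e} vs → Ignores v e → ∀ {σ τ} → AgreeOff v σ τ → count vs e σ ≡ count vs e τ
  count-ignores []       ignores agree = cong (λ b → if b then 1 else 0) (ignores agree)
  count-ignores (w ∷ vs) ignores agree =
    cong₂ _+_ (count-ignores vs ignores (AgreeOff-update w true agree))
              (count-ignores vs ignores (AgreeOff-update w false agree))

  count-fixed : ∀ {v b} vs → v ∉ vs → (e e′ : Event) → (∀ τ → τ v ≡ b → e τ ≡ e′ τ) →
                ∀ σ → σ v ≡ b → count vs e σ ≡ count vs e′ σ
  count-fixed []       v∉ e e′ same σ σv = cong (λ b → if b then 1 else 0) (same σ σv)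
  count-fixed (w ∷ vs) v∉ e e′ same σ σv =
    cong₂ _+_ (count-fixed vs (v∉ ∘ there) e e′ same _ (trans (update-other σ true (v∉ ∘ here)) σv))
              (count-fixed vs (v∉ ∘ there) e e′ same _ (trans (update-other σ false (v∉ ∘ here)) σv))

  count-split : ∀ {v} vs → Unique vs → v ∈ vs → (e₁ e₂ : Event) → Ignores v e₁ → Ignores v e₂ → ∀ σ →
                2 * count vs (λ τ → if τ v then e₁ τ else e₂ τ) σ ≡ count vs e₁ σ + count vs e₂ σ
  count-split (v ∷ vs) unique (here refl) e₁ e₂ ignores₁ ignores₂ σ = begin
    2 * (count vs e σ₁ + count vs e σ₀)
      ≡⟨ cong (2 *_) (cong₂ _+_ (count-fixed vs v∉vs e e₁ branch σ₁ (update-same σ v true))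
                               (count-fixed vs v∉vs e e₂ branch σ₀ (update-same σ v false))) ⟩
    2 * (count vs e₁ σ₁ + count vs e₂ σ₀)
      ≡⟨ double (count vs e₁ σ₁) (count vs e₂ σ₀) ⟩
    (count vs e₁ σ₁ + count vs e₁ σ₁) + (count vs e₂ σ₀ + count vs e₂ σ₀)
      ≡⟨ cong₂ (λ x y → (count vs e₁ σ₁ + x) + (y + count vs e₂ σ₀))
               (count-ignores vs ignores₁ (AgreeOff-flip σ v))
               (sym (count-ignores vs ignores₂ (AgreeOff-flip σ v))) ⟩
    (count vs e₁ σ₁ + count vs e₁ σ₀) + (count vs e₂ σ₁ + count vs e₂ σ₀) ∎
    where
    open ≡-Reasoning
    e : Event
    e τ = if τ v then e₁ τ else e₂ τ
    branch : ∀ {b} τ → τ v ≡ b → e τ ≡ (if b then e₁ τ else e₂ τ)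
    branch τ = cong (if_then e₁ τ else e₂ τ)
    σ₁ = σ [ v ≔ true ]
    σ₀ = σ [ v ≔ false ]
    v∉vs : v ∉ vs
    v∉vs = Unique[x∷xs]⇒x∉xs unique
    double : ∀ a b → 2 * (a + b) ≡ (a + a) + (b + b)
    double = solve-∀
  count-split {v} (w ∷ vs) (_ ∷ unique) (there v∈vs) e₁ e₂ ignores₁ ignores₂ σ = begin
    2 * (count vs e σ₁ + count vs e σ₀)
      ≡⟨ *-distribˡ-+ 2 (count vs e σ₁) (count vs e σ₀) ⟩
    2 * count vs e σ₁ + 2 * count vs e σ₀
      ≡⟨ cong₂ _+_ (count-split vs unique v∈vs e₁ e₂ ignores₁ ignores₂ σ₁)
                   (count-split vs unique v∈vs e₁ e₂ ignores₁ ignores₂ σ₀) ⟩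
    (count vs e₁ σ₁ + count vs e₂ σ₁) + (count vs e₁ σ₀ + count vs e₂ σ₀)
      ≡⟨ interchange (count vs e₁ σ₁) (count vs e₂ σ₁) _ _ ⟩
    (count vs e₁ σ₁ + count vs e₁ σ₀) + (count vs e₂ σ₁ + count vs e₂ σ₀) ∎
    where
    open ≡-Reasoning
    e : Event
    e τ = if τ v then e₁ τ else e₂ τ
    σ₁ = σ [ w ≔ true ]
    σ₀ = σ [ w ≔ false ]

  assignments : List V → Assignment → List Assignment
  assignments []       σ = σ ∷ []
  assignments (v ∷ vs) σ = assignments vs (σ [ v ≔ true ]) ++ assignments vs (σ [ v ≔ false ])

  satisfying : Event → List Assignment → List Assignment
  satisfying e = filter (λ τ → e τ Bool.≟ true)

  length-satisfying : ∀ vs e σ → length (satisfying e (assignments vs σ)) ≡ count vs e σ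
  length-satisfying []       e σ with e σ
  ... | true  = refl
  ... | false = refl
  length-satisfying (v ∷ vs) e σ = begin
    length (satisfying e (assignments vs σ₁ ++ assignments vs σ₀))
      ≡⟨ cong length (filter-++ (λ τ → e τ Bool.≟ true) (assignments vs σ₁) (assignments vs σ₀)) ⟩
    length (satisfying e (assignments vs σ₁) ++ satisfying e (assignments vs σ₀))
      ≡⟨ length-++ (satisfying e (assignments vs σ₁)) ⟩
    length (satisfying e (assignments vs σ₁)) + length (satisfying e (assignments vs σ₀))
      ≡⟨ cong₂ _+_ (length-satisfying vs e σ₁) (length-satisfying vs e σ₀) ⟩
    count vs e σ₁ + count vs e σ₀ ∎
    where
    open ≡-Reasoning
    σ₁ = σ [ v ≔ true ]
    σ₀ = σ [ v ≔ false ]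

  ∈-assignments-fixed : ∀ {v τ} vs σ → v ∉ vs → τ ∈ assignments vs σ → τ v ≡ σ v
  ∈-assignments-fixed []       σ v∉ (here refl) = refl
  ∈-assignments-fixed {v} (w ∷ vs) σ v∉ τ∈ with ∈-++⁻ (assignments vs (σ [ w ≔ true ])) τ∈
  ... | inj₁ τ∈₁ = trans (∈-assignments-fixed vs _ (v∉ ∘ there) τ∈₁) (update-other σ true (v∉ ∘ here))
  ... | inj₂ τ∈₀ = trans (∈-assignments-fixed vs _ (v∉ ∘ there) τ∈₀) (update-other σ false (v∉ ∘ here))

  DifferOn : List V → Assignment → Assignment → Set
  DifferOn vs σ τ = ∃[ v ] v ∈ vs × σ v ≢ τ v

  assignments-differ : ∀ vs σ → Unique vs → AllPairs (DifferOn vs) (assignments vs σ)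
  assignments-differ []       σ unique = [] ∷ []
  assignments-differ (v ∷ vs) σ unique@(_ ∷ unique′) =
    AllPairs.++⁺ (weaken (assignments-differ vs _ unique′))
                 (weaken (assignments-differ vs _ unique′))
                 (All.tabulate λ τ₁∈ → All.tabulate λ τ₀∈ → v , here refl , λ eq →
                   true≢false (trans (sym (fixed true τ₁∈)) (trans eq (fixed false τ₀∈))))
    where
    v∉vs = Unique[x∷xs]⇒x∉xs unique
    weaken : ∀ {τs} → AllPairs (DifferOn vs) τs → AllPairs (DifferOn (v ∷ vs)) τs
    weaken = AllPairs.map (λ (u , u∈ , ne) → u , there u∈ , ne)
    fixed : ∀ b {τ} → τ ∈ assignments vs (σ [ v ≔ b ]) → τ v ≡ b
    fixed b τ∈ = trans (∈-assignments-fixed vs _ v∉vs τ∈) (update-same σ v b)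

  anyOf : List Event → Event
  anyOf []       σ = false
  anyOf (e ∷ es) σ = e σ ∨ anyOf es σ

  anyOf-false : ∀ es σ → anyOf es σ ≡ false → ∀ {e} → e ∈ es → e σ ≡ false
  anyOf-false (e ∷ es) σ none (here refl) = Bool.∨-conicalˡ (e σ) (anyOf es σ) none
  anyOf-false (e ∷ es) σ none (there e∈) = anyOf-false es σ (Bool.∨-conicalʳ (e σ) (anyOf es σ) none) e∈

  union-bound : ∀ vs es σ {K N} → (∀ {e} → e ∈ es → K * count vs e σ ≤ N) →
                K * count vs (anyOf es) σ ≤ length es * N
  union-bound vs []       σ {K} _     = ≤-reflexive (trans (cong (K *_) (count-never vs σ)) (*-zeroʳ K))
  union-bound vs (e ∷ es) σ {K} {N} bound = begin
    K * count vs (anyOf (e ∷ es)) σ               ≤⟨ *-monoʳ-≤ K (count-∨ vs e (anyOf es) σ) ⟩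
    K * (count vs e σ + count vs (anyOf es) σ)    ≡⟨ *-distribˡ-+ K _ _ ⟩
    K * count vs e σ + K * count vs (anyOf es) σ  ≤⟨ +-mono-≤ (bound (here refl)) (union-bound vs es σ {K} (bound ∘ there)) ⟩
    N + length es * N ∎
    where open ≤-Reasoning

  fewerThan : ℕ → List V → Event
  fewerThan zero    ws       σ = false
  fewerThan (suc D) []       σ = true
  fewerThan (suc D) (w ∷ ws) σ = if σ w then fewerThan D ws σ else fewerThan (suc D) ws σ

  fewerThan-ignores : ∀ {v} D ws → v ∉ ws → Ignores v (fewerThan D ws)
  fewerThan-ignores zero    ws       v∉ agree = refl
  fewerThan-ignores (suc D) []       v∉ agree = refl
  fewerThan-ignores (suc D) (w ∷ ws) v∉ agree
    rewrite agree w (λ w≡v → v∉ (here (sym w≡v)))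
          | fewerThan-ignores D ws (v∉ ∘ there) agree
          | fewerThan-ignores (suc D) ws (v∉ ∘ there) agree = refl

  -- A slot is a variable with a partner variable, where nothing is a partner that is never true.
  -- firstPartnered D holds when the first D slots with a true variable all have true partners.
  Slot : Set
  Slot = V × Maybe V

  slotVars : Slot → List V
  slotVars (v , r) = v ∷ fromMaybe r

  firstPartnered : ℕ → List Slot → Event
  firstPartnered zero    ss                  σ = true
  firstPartnered (suc D) []                  σ = false
  firstPartnered (suc D) ((v , nothing) ∷ ss) σ = if σ v then false else firstPartnered (suc D) ss σ
  firstPartnered (suc D) ((v , just r) ∷ ss)  σ =
    if σ v then (if σ r then firstPartnered D ss σ else false) else firstPartnered (suc D) ss σ

  firstPartnered-ignores : ∀ {v} D ss → v ∉ concatMap slotVars ss → Ignores v (firstPartnered D ss)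
  firstPartnered-ignores zero    ss                  v∉ agree = refl
  firstPartnered-ignores (suc D) []                  v∉ agree = refl
  firstPartnered-ignores (suc D) ((w , nothing) ∷ ss) v∉ agree
    rewrite agree w (λ w≡v → v∉ (here (sym w≡v)))
          | firstPartnered-ignores (suc D) ss (v∉ ∘ there) agree = refl
  firstPartnered-ignores (suc D) ((w , just r) ∷ ss)  v∉ agree
    rewrite agree w (λ w≡v → v∉ (here (sym w≡v)))
          | agree r (λ r≡v → v∉ (there (here (sym r≡v))))
          | firstPartnered-ignores D ss (v∉ ∘ there ∘ there) agree
          | firstPartnered-ignores (suc D) ss (v∉ ∘ there ∘ there) agree = refl

  fewerThan-false⇒length-takeFirst : ∀ {A : Set} D (f : A → V) ws σ →
    fewerThan D (map f ws) σ ≡ false → length (takeFirst D (σ ∘ f) ws) ≡ D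
  fewerThan-false⇒length-takeFirst zero    f ws       σ _ = refl
  fewerThan-false⇒length-takeFirst (suc D) f (w ∷ ws) σ none with σ (f w)
  ... | true  = cong suc (fewerThan-false⇒length-takeFirst D f ws σ none)
  ... | false = fewerThan-false⇒length-takeFirst (suc D) f ws σ none

  takeFirst⇒firstPartnered : ∀ {A : Set} D (f : A → V) (p : A → Maybe V) ws σ →
    length (takeFirst D (σ ∘ f) ws) ≡ D →
    (∀ {w} → w ∈ takeFirst D (σ ∘ f) ws → ∃[ r ] p w ≡ just r × σ r ≡ true) →
    firstPartnered D (map (λ w → f w , p w) ws) σ ≡ true
  takeFirst⇒firstPartnered zero    f p ws       σ _ _ = refl
  takeFirst⇒firstPartnered (suc D) f p (w ∷ ws) σ len partnered with σ (f w) in σfw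
  ... | false with p w
  ...   | nothing rewrite σfw = takeFirst⇒firstPartnered (suc D) f p ws σ len partnered
  ...   | just _  rewrite σfw = takeFirst⇒firstPartnered (suc D) f p ws σ len partnered
  takeFirst⇒firstPartnered (suc D) f p (w ∷ ws) σ len partnered | true with partnered (here refl)
  ...   | r , pw , σr rewrite pw | σfw | σr =
    takeFirst⇒firstPartnered D f p ws σ (suc-injective len) (partnered ∘ there)

  module _ {vs : List V} (vs-unique : Unique vs) where

    -- Markov's inequality for 3 ^ (D − #true), whose mean is 3 ^ D (2/3) ^ k when k variables are read.
    fewerThan-bound : ∀ D ws σ → Unique ws → All (_∈ vs) ws →
                      6 ^ length ws * count vs (fewerThan D ws) σ ≤ 2 ^ length vs * (4 ^ length ws * 3 ^ D)
    fewerThan-bound zero ws σ _ _ =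
      ≤-trans (≤-reflexive (trans (cong (6 ^ length ws *_) (count-never vs σ)) (*-zeroʳ (6 ^ length ws)))) z≤n
    fewerThan-bound (suc D) [] σ _ _ = begin
      1 * count vs (fewerThan (suc D) []) σ ≡⟨ *-identityˡ _ ⟩
      count vs (fewerThan (suc D) []) σ     ≤⟨ count-≤ vs _ σ ⟩
      2 ^ length vs                         ≤⟨ m≤m*n (2 ^ length vs) (3 ^ suc D) {{m^n≢0 3 (suc D)}} ⟩
      2 ^ length vs * 3 ^ suc D             ≡⟨ cong (2 ^ length vs *_) (sym (*-identityˡ _)) ⟩
      2 ^ length vs * (1 * 3 ^ suc D) ∎
      where open ≤-Reasoning
    fewerThan-bound (suc D) (w ∷ ws) σ unique (w∈vs ∷ ws⊆vs) = begin
      6 * 6 ^ k * c                            ≡⟨ rearrange (6 ^ k) c ⟩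
      3 * (6 ^ k * (2 * c))                    ≡⟨ cong (λ x → 3 * (6 ^ k * x)) split ⟩
      3 * (6 ^ k * (c₀ + c₁))                  ≡⟨ cong (3 *_) (*-distribˡ-+ (6 ^ k) c₀ c₁) ⟩
      3 * (6 ^ k * c₀ + 6 ^ k * c₁)            ≤⟨ *-monoʳ-≤ 3 (+-mono-≤ (fewerThan-bound D ws σ unique′ ws⊆vs)
                                                                       (fewerThan-bound (suc D) ws σ unique′ ws⊆vs)) ⟩
      3 * (P * (4 ^ k * 3 ^ D) + P * (4 ^ k * 3 ^ suc D)) ≡⟨ collect P (4 ^ k) (3 ^ D) ⟩
      P * (4 * 4 ^ k * 3 ^ suc D) ∎
      where
      open ≤-Reasoning
      k = length ws
      P = 2 ^ length vs
      c = count vs (fewerThan (suc D) (w ∷ ws)) σ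
      c₀ = count vs (fewerThan D ws) σ
      c₁ = count vs (fewerThan (suc D) ws) σ
      unique′ = AllPairs.tail unique
      w∉ws = Unique[x∷xs]⇒x∉xs unique
      split : 2 * c ≡ c₀ + c₁
      split = count-split vs vs-unique w∈vs (fewerThan D ws) (fewerThan (suc D) ws)
                (fewerThan-ignores D ws w∉ws) (fewerThan-ignores (suc D) ws w∉ws) σ
      rearrange : ∀ x y → 6 * x * y ≡ 3 * (x * (2 * y))
      rearrange = solve-∀
      collect : ∀ x y z → 3 * (x * (y * z) + x * (y * (3 * z))) ≡ x * (4 * y * (3 * z))
      collect = solve-∀

    fewerThan-rare : ∀ D ws σ → Unique ws → All (_∈ vs) ws → length ws ≡ 8 * D →
                     2 ^ D * count vs (fewerThan D ws) σ ≤ 2 ^ length vs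
    fewerThan-rare D ws σ unique ws⊆vs len = *-cancelˡ-≤ (6 ^ (8 * D)) {{m^n≢0 6 (8 * D)}} (begin
      6 ^ (8 * D) * (2 ^ D * c)               ≡⟨ swap (6 ^ (8 * D)) (2 ^ D) c ⟩
      2 ^ D * (6 ^ (8 * D) * c)               ≤⟨ *-monoʳ-≤ (2 ^ D) bound ⟩
      2 ^ D * (P * (4 ^ (8 * D) * 3 ^ D))     ≡⟨ regroup (2 ^ D) P (4 ^ (8 * D)) (3 ^ D) ⟩
      P * (2 ^ D * 4 ^ (8 * D) * 3 ^ D)       ≤⟨ *-monoʳ-≤ P (2^D*4^[8D]*3^D≤6^[8D] D) ⟩
      P * 6 ^ (8 * D)                         ≡⟨ *-comm P (6 ^ (8 * D)) ⟩
      6 ^ (8 * D) * P ∎)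
      where
      open ≤-Reasoning
      P = 2 ^ length vs
      c = count vs (fewerThan D ws) σ
      bound : 6 ^ (8 * D) * c ≤ P * (4 ^ (8 * D) * 3 ^ D)
      bound = subst (λ k → 6 ^ k * c ≤ P * (4 ^ k * 3 ^ D)) len (fewerThan-bound D ws σ unique ws⊆vs)
      swap : ∀ x y z → x * (y * z) ≡ y * (x * z)
      swap = solve-∀
      regroup : ∀ w x y z → w * (x * (y * z)) ≡ x * (w * y * z)
      regroup = solve-∀

    firstPartnered-rare : ∀ D ss σ → Unique (concatMap slotVars ss) → All (_∈ vs) (concatMap slotVars ss) →
                          2 ^ D * count vs (firstPartnered D ss) σ ≤ 2 ^ length vs
    firstPartnered-rare zero ss σ _ _ = ≤-trans (≤-reflexive (*-identityˡ _)) (count-≤ vs _ σ)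
    firstPartnered-rare (suc D) [] σ _ _ =
      ≤-trans (≤-reflexive (trans (cong (2 ^ suc D *_) (count-never vs σ)) (*-zeroʳ (2 ^ suc D)))) z≤n
    firstPartnered-rare (suc D) ((v , nothing) ∷ ss) σ unique (v∈vs ∷ ss⊆vs) = begin
      2 * K * c   ≡⟨ *-assoc 2 K c ⟩
      2 * (K * c) ≡⟨ *-comm 2 (K * c) ⟩
      K * c * 2   ≡⟨ *-assoc K c 2 ⟩
      K * (c * 2) ≡⟨ cong (K *_) (trans (*-comm c 2) split) ⟩
      K * c₁      ≤⟨ *-monoˡ-≤ c₁ (m≤n*m K 2) ⟩
      2 * K * c₁  ≤⟨ firstPartnered-rare (suc D) ss σ (AllPairs.tail unique) ss⊆vs ⟩
      2 ^ length vs ∎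
      where
      open ≤-Reasoning
      K = 2 ^ D
      c = count vs (firstPartnered (suc D) ((v , nothing) ∷ ss)) σ
      c₁ = count vs (firstPartnered (suc D) ss) σ
      split : 2 * c ≡ c₁
      split = trans (count-split vs vs-unique v∈vs (λ _ → false) (firstPartnered (suc D) ss) (λ _ → refl)
                       (firstPartnered-ignores (suc D) ss (Unique[x∷xs]⇒x∉xs unique)) σ)
                    (cong (_+ c₁) (count-never vs σ))
    firstPartnered-rare (suc D) ((v , just r) ∷ ss) σ unique (v∈vs ∷ r∈vs ∷ ss⊆vs) =
      *-cancelˡ-≤ 4 (begin
        4 * (2 * K * c)                        ≡⟨ expand K c ⟩
        2 * K * (2 * (2 * c))                  ≡⟨ cong (λ x → 2 * K * (2 * x)) split ⟩
        2 * K * (2 * (cᵢ + c₁))                ≡⟨ distribute K cᵢ c₁ ⟩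
        K * (2 * (2 * cᵢ)) + 2 * (2 * K * c₁)  ≡⟨ cong (λ x → K * (2 * x) + 2 * (2 * K * c₁)) split-inner ⟩
        K * (2 * c₀) + 2 * (2 * K * c₁)        ≡⟨ cong (_+ 2 * (2 * K * c₁)) (swap K c₀) ⟩
        2 * (K * c₀) + 2 * (2 * K * c₁)        ≤⟨ +-mono-≤ (*-monoʳ-≤ 2 (firstPartnered-rare D ss σ unique″ ss⊆vs))
                                                           (*-monoʳ-≤ 2 (firstPartnered-rare (suc D) ss σ unique″ ss⊆vs)) ⟩
        2 * P + 2 * P                          ≡⟨ double P ⟩
        4 * P ∎)
      where
      open ≤-Reasoning
      K = 2 ^ D
      P = 2 ^ length vs
      v∉ = Unique[x∷xs]⇒x∉xs unique
      unique′ = AllPairs.tail unique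
      unique″ = AllPairs.tail unique′
      inner : Event
      inner τ = if τ r then firstPartnered D ss τ else false
      c = count vs (firstPartnered (suc D) ((v , just r) ∷ ss)) σ
      cᵢ = count vs inner σ
      c₀ = count vs (firstPartnered D ss) σ
      c₁ = count vs (firstPartnered (suc D) ss) σ
      inner-ignores : Ignores v inner
      inner-ignores agree = cong₂ (λ b x → if b then x else false)
        (agree r (λ r≡v → v∉ (here (sym r≡v)))) (firstPartnered-ignores D ss (v∉ ∘ there) agree)
      split : 2 * c ≡ cᵢ + c₁
      split = count-split vs vs-unique v∈vs inner (firstPartnered (suc D) ss) inner-ignores
                (firstPartnered-ignores (suc D) ss (v∉ ∘ there)) σ
      split-inner : 2 * cᵢ ≡ c₀
      split-inner = trans (count-split vs vs-unique r∈vs (firstPartnered D ss) (λ _ → false)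
                             (firstPartnered-ignores D ss (Unique[x∷xs]⇒x∉xs unique′)) (λ _ → refl) σ)
                          (trans (cong (c₀ +_) (count-never vs σ)) (+-identityʳ c₀))
      expand : ∀ x y → 4 * (2 * x * y) ≡ 2 * x * (2 * (2 * y))
      expand = solve-∀
      distribute : ∀ x y z → 2 * x * (2 * (y + z)) ≡ x * (2 * (2 * y)) + 2 * (2 * x * z)
      distribute = solve-∀
      swap : ∀ x y → x * (2 * y) ≡ 2 * (x * y)
      swap = solve-∀
      double : ∀ x → 2 * x + 2 * x ≡ 4 * x
      double = solve-∀

-- Rigid frames yield cold maps

record RigidFrame {n : ℕ} (G : Graph n) (d : ℕ) : Set₁ where
  field
    Core               : Fin n → Set
    child              : Fin n → Fin d → Fin n
    root other         : Fin n
    root-core          : Core root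
    other≢root         : other ≢ root
    child-adjacent     : ∀ {x} → Core x → ∀ c → Adj G x (child x c)
    child-core         : ∀ {x} → Core x → ∀ c → Core (child x c)
    children-determine : ∀ {x} → Core x → ∀ u → (∀ c → Adj G u (child x c)) → u ≡ x

module _ {n : ℕ} {G : Graph n} {d : ℕ} (F : RigidFrame G d) where
  open RigidFrame F

  unfold : TVertex d → Fin n
  unfold []      = root
  unfold (c ∷ w) = child (unfold w) c

  unfold-core : ∀ w → Core (unfold w)
  unfold-core []      = root-core
  unfold-core (c ∷ w) = child-core (unfold-core w) c

  unfold-hom : IsHom d G unfold
  unfold-hom w c = child-adjacent (unfold-core w) c

  unfold-cold : IsCold d G unfold
  unfold-cold = other , λ k (ψ , ψ-hom , agree , ψ[]≡other) →
    other≢root (trans (sym ψ[]≡other) (agree-upward ψ ψ-hom agree k [] refl))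
    where
    agree-upward : ∀ {k} ψ → IsHom d G ψ → (∀ w → length w ≡ k → ψ w ≡ unfold w) →
                   ∀ j w → length w + j ≡ k → ψ w ≡ unfold w
    agree-upward ψ ψ-hom agree zero    w eq = agree w (trans (sym (+-identityʳ (length w))) eq)
    agree-upward ψ ψ-hom agree (suc j) w eq = children-determine (unfold-core w) (ψ w) λ c →
      subst (Adj G (ψ w)) (agree-upward ψ ψ-hom agree j (c ∷ w) (trans (sym (+-suc (length w) j)) eq)) (ψ-hom w c)

rigidFrame⇒¬warm : ∀ {n} {G : Graph n} {d} → RigidFrame G (d ∸ 2) → ¬ IsWarm d G
rigidFrame⇒¬warm F warm = warm (unfold F) (unfold-hom F) (unfold-cold F)

rigidFrames⇒warmthBound : ∀ {n} {G : Graph n} a b D → (∀ d → D ≤ d → RigidFrame G d) →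
                          2 ^ (D * b) ≤ n ^ (a + b) → WarmthBound a b G
rigidFrames⇒warmthBound a b D frame bound d warm with D ≤? d ∸ 2
... | yes D≤d∸2 = ⊥-elim (rigidFrame⇒¬warm {d = d} (frame (d ∸ 2) D≤d∸2) warm)
... | no  D≰d∸2 = ≤-trans (^-monoʳ-≤ 2 (*-monoˡ-≤ b (d∸1≤D d (≰⇒> D≰d∸2)))) bound
  where
  d∸1≤D : ∀ d → d ∸ 2 < D → d ∸ 1 ≤ D
  d∸1≤D zero          _  = z≤n
  d∸1≤D (suc zero)    _  = z≤n
  d∸1≤D (suc (suc d)) lt = lt

-- Graphs on Fin n as assignments of the variables (i , j) with i < j

Pair : ℕ → Set
Pair n = Fin n × Fin n

_≟ₚ_ : ∀ {n} → DecidableEquality (Pair n)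
_≟ₚ_ = ≡-dec Fin._≟_ Fin._≟_

toGraph : ∀ {n} → (Pair n → Bool) → Graph n
toGraph σ i j = σ (i , j)

upperPairs : (n : ℕ) → List (Pair n)
upperPairs zero    = []
upperPairs (suc n) = map (λ j → Fin.zero , Fin.suc j) (allFin n) ++ map (Product.map Fin.suc Fin.suc) (upperPairs n)

length-upperPairs : ∀ n → length (upperPairs n) ≡ n C 2
length-upperPairs zero    = refl
length-upperPairs (suc n) = begin
  length (upperPairs (suc n))
    ≡⟨ length-++ (map (λ j → Fin.zero , Fin.suc j) (allFin n)) ⟩
  length (map (λ j → Fin.zero , Fin.suc j) (allFin n)) + length (map (Product.map Fin.suc Fin.suc) (upperPairs n))
    ≡⟨ cong₂ _+_ (trans (length-map _ (allFin n)) (length-tabulate _))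
                 (trans (length-map _ (upperPairs n)) (length-upperPairs n)) ⟩
  n + n C 2
    ≡⟨ cong (_+ n C 2) (sym (nC1≡n n)) ⟩
  n C 1 + n C 2
    ≡⟨ nCk+nC[k+1]≡[n+1]C[k+1] n 1 ⟩
  suc n C 2 ∎
  where open ≡-Reasoning

upperPairs-ordered : ∀ n → All (λ p → proj₁ p Fin.< proj₂ p) (upperPairs n)
upperPairs-ordered zero    = []
upperPairs-ordered (suc n) = All.++⁺ (All.map⁺ (All.tabulate⁺ (λ _ → s≤s z≤n)))
                                     (All.map⁺ (All.map s≤s (upperPairs-ordered n)))

∈-upperPairs : ∀ {n} {i j : Fin n} → i Fin.< j → (i , j) ∈ upperPairs n
∈-upperPairs {suc n} {Fin.zero}  {Fin.suc j} _ = ∈-++⁺ˡ (∈-map⁺ (λ j → Fin.zero , Fin.suc j) (∈-allFin j))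
∈-upperPairs {suc n} {Fin.suc i} {Fin.suc j} (s≤s i<j) =
  ∈-++⁺ʳ (map (λ j → Fin.zero , Fin.suc j) (allFin n)) (∈-map⁺ (Product.map Fin.suc Fin.suc) (∈-upperPairs i<j))

upperPairs-unique : ∀ n → Unique (upperPairs n)
upperPairs-unique zero    = []
upperPairs-unique (suc n) =
  Unique.++⁺ (Unique.map⁺ (λ eq → Fin.suc-injective (cong proj₂ eq)) (Unique.allFin⁺ n))
             (Unique.map⁺ suc×suc-injective (upperPairs-unique n))
             λ (∈first , ∈rest) → first∩rest (∈-map⁻ (λ j → Fin.zero , Fin.suc j) ∈first)
                                          (∈-map⁻ (Product.map Fin.suc Fin.suc) ∈rest)
  where
  suc×suc-injective : ∀ {p q : Pair n} → Product.map Fin.suc Fin.suc p ≡ Product.map Fin.suc Fin.suc q → p ≡ q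
  suc×suc-injective {_ , _} {_ , _} eq =
    cong₂ _,_ (Fin.suc-injective (cong proj₁ eq)) (Fin.suc-injective (cong proj₂ eq))
  first∩rest : ∀ {v} → ∃[ j ] j ∈ allFin n × v ≡ (Fin.zero , Fin.suc j) →
               ∃[ p ] p ∈ upperPairs n × v ≡ Product.map Fin.suc Fin.suc p → ⊥
  first∩rest (_ , _ , refl) (_ , _ , ())

edge : ∀ {n} → Fin n → Fin n → Pair n
edge x w with w Fin.<? x
... | yes _ = w , x
... | no  _ = x , w

edge-injective : ∀ {n} {x w x′ w′ : Fin n} → edge x w ≡ edge x′ w′ → (x ≡ x′ × w ≡ w′) ⊎ (x ≡ w′ × w ≡ x′)
edge-injective {x = x} {w} {x′} {w′} eq with w Fin.<? x | w′ Fin.<? x′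
... | yes _ | yes _ = inj₁ (cong proj₂ eq , cong proj₁ eq)
... | yes _ | no  _ = inj₂ (cong proj₂ eq , cong proj₁ eq)
... | no  _ | yes _ = inj₂ (cong proj₁ eq , cong proj₂ eq)
... | no  _ | no  _ = inj₁ (cong proj₁ eq , cong proj₂ eq)

edge-injectiveʳ : ∀ {n} {x w w′ : Fin n} → edge x w ≡ edge x w′ → w ≡ w′
edge-injectiveʳ eq with edge-injective eq
... | inj₁ (_ , w≡w′)     = w≡w′
... | inj₂ (x≡w′ , w≡x) = trans w≡x x≡w′

<-from-≮-≢ : ∀ {n} {x w : Fin n} → ¬ w Fin.< x → x ≢ w → x Fin.< w
<-from-≮-≢ w≮x x≢w = Fin.≤∧≢⇒< (≮⇒≥ w≮x) x≢w

edge∈upperPairs : ∀ {n} {x w : Fin n} → x ≢ w → edge x w ∈ upperPairs n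
edge∈upperPairs {x = x} {w} x≢w with w Fin.<? x
... | yes w<x = ∈-upperPairs w<x
... | no  w≮x = ∈-upperPairs (<-from-≮-≢ w≮x x≢w)

module _ {n : ℕ} (σ : Pair n → Bool) where

  adjacent⇒edge : ∀ {x w} → Adj (toGraph σ) x w → σ (edge x w) ≡ true
  adjacent⇒edge {x} {w} adj with w Fin.<? x | adj
  ... | yes _   | inj₂ (_ , σwx) = σwx
  ... | yes w<x | inj₁ (x<w , _) = ⊥-elim (Fin.<-asym w<x x<w)
  ... | no  _   | inj₁ (_ , σxw) = σxw
  ... | no  w≮x | inj₂ (w<x , _) = ⊥-elim (w≮x w<x)

  edge⇒adjacent : ∀ {x w} → x ≢ w → σ (edge x w) ≡ true → Adj (toGraph σ) x w
  edge⇒adjacent {x} {w} x≢w σxw with w Fin.<? x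
  ... | yes w<x = inj₂ (w<x , σxw)
  ... | no  w≮x = inj₁ (<-from-≮-≢ w≮x x≢w , σxw)

Adj-irreflexive : ∀ {n} (G : Graph n) x → ¬ Adj G x x
Adj-irreflexive G x (inj₁ (x<x , _)) = Fin.<-irrefl refl x<x
Adj-irreflexive G x (inj₂ (x<x , _)) = Fin.<-irrefl refl x<x

module _ {n : ℕ} where
  open BooleanCube (_≟ₚ_ {n})

  probAtLeast-fromBad : ∀ q (P : Graph n → Set) (bad : Event) → (∀ σ → bad σ ≡ false → P (toGraph σ)) →
    q * count (upperPairs n) bad (λ _ → false) ≤ numGraphs n → ProbAtLeast1-1/ q n P
  probAtLeast-fromBad q P bad good⇒P bounded =
    map toGraph goods ,
    AllPairs.map⁺ (AllPairs.map differ⇒different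
                                (AllPairs.filter⁺ _ (assignments-differ vs σ₀ (upperPairs-unique n)))) ,
    All.map⁺ (All.map (λ not-bad → good⇒P _ (Bool.not-injective not-bad))
                      (All.all-filter (λ τ → not (bad τ) Bool.≟ true) (assignments vs σ₀))) ,
    subst (λ m → q * m ≤ numGraphs n) (sym missing≡bad) bounded
    where
    vs = upperPairs n
    σ₀ : Assignment
    σ₀ _ = false
    goods = satisfying (not ∘ bad) (assignments vs σ₀)
    differ⇒different : ∀ {τ τ′} → DifferOn vs τ τ′ → DifferentGraphs (toGraph τ) (toGraph τ′)
    differ⇒different ((i , j) , ij∈ , ne) = i , j , All.lookup (upperPairs-ordered n) ij∈ , ne
    numGraphs≡ : numGraphs n ≡ 2 ^ length vs
    numGraphs≡ = cong (2 ^_) (sym (length-upperPairs n))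
    missing≡bad : numGraphs n ∸ length (map toGraph goods) ≡ count vs bad σ₀
    missing≡bad = begin
      numGraphs n ∸ length (map toGraph goods)
        ≡⟨ cong₂ _∸_ numGraphs≡ (trans (length-map toGraph goods) (length-satisfying vs (not ∘ bad) σ₀)) ⟩
      2 ^ length vs ∸ count vs (not ∘ bad) σ₀
        ≡⟨ cong (_∸ count vs (not ∘ bad) σ₀) (sym (count-complement vs bad σ₀)) ⟩
      count vs bad σ₀ + count vs (not ∘ bad) σ₀ ∸ count vs (not ∘ bad) σ₀
        ≡⟨ m+n∸n≡m (count vs bad σ₀) (count vs (not ∘ bad) σ₀) ⟩
      count vs bad σ₀ ∎
      where open ≡-Reasoning

  -- No vertex is adjacent to itself, so u has no edge variable towards w = u.
  partnerOf : Fin n → Fin n → Maybe (Pair n)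
  partnerOf u w = if does (w Fin.≟ u) then nothing else just (edge u w)

  partnerOf-≢ : ∀ {u w} → w ≢ u → partnerOf u w ≡ just (edge u w)
  partnerOf-≢ {u} {w} w≢u with w Fin.≟ u
  ... | yes w≡u = ⊥-elim (w≢u w≡u)
  ... | no  _   = refl

  fewNeighbours : ℕ → Fin n → List (Fin n) → Event
  fewNeighbours D x ws = fewerThan D (map (edge x) ws)

  -- u is adjacent to each of the first D neighbours of x in ws.
  covers : ℕ → Fin n → Fin n → List (Fin n) → Event
  covers D u x ws = firstPartnered D (map (λ w → edge x w , partnerOf u w) ws)

  ∈-slotVars⁻ : ∀ {x u w : Fin n} {b} → b ∈ slotVars (edge x w , partnerOf u w) →
                b ≡ edge x w ⊎ (w ≢ u × b ≡ edge u w)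
  ∈-slotVars⁻ (here b≡) = inj₁ b≡
  ∈-slotVars⁻ {u = u} {w} (there b∈) with w Fin.≟ u
  ∈-slotVars⁻ (there (here b≡)) | no w≢u = inj₂ (w≢u , b≡)

  edge≢edge : ∀ {x u w w′ : Fin n} → x ≢ u → x ≢ w′ → edge x w ≢ edge u w′
  edge≢edge x≢u x≢w′ eq with edge-injective eq
  ... | inj₁ (x≡u , _)  = x≢u x≡u
  ... | inj₂ (x≡w′ , _) = x≢w′ x≡w′

  module _ {x : Fin n} {ws : List (Fin n)} (x∉ws : x ∉ ws) where

    private
      x≢ : ∀ {w} → w ∈ ws → x ≢ w
      x≢ w∈ x≡w = x∉ws (subst (_∈ ws) (sym x≡w) w∈)

    fewNeighbours-rare : ∀ D σ → Unique ws → length ws ≡ 8 * D →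
      2 ^ D * count (upperPairs n) (fewNeighbours D x ws) σ ≤ 2 ^ length (upperPairs n)
    fewNeighbours-rare D σ unique len =
      fewerThan-rare (upperPairs-unique n) D (map (edge x) ws) σ
        (Unique.map⁺ edge-injectiveʳ unique)
        (All.map⁺ (All.tabulate (edge∈upperPairs ∘ x≢)))
        (trans (length-map (edge x) ws) len)

    covers-rare : ∀ D u σ → u ≢ x → Unique ws →
      2 ^ D * count (upperPairs n) (covers D u x ws) σ ≤ 2 ^ length (upperPairs n)
    covers-rare D u σ u≢x unique =
      firstPartnered-rare (upperPairs-unique n) D slots σ
        (subst Unique (sym vars≡) (concatMap-unique slotVarsOf unique slot-unique slot-determined))
        (subst (All (_∈ upperPairs n)) (sym vars≡) (All.tabulate slotVar∈upperPairs))
      where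
      slotOf : Fin n → Slot
      slotOf w = edge x w , partnerOf u w
      slotVarsOf : Fin n → List (Pair n)
      slotVarsOf = slotVars ∘ slotOf
      slots = map slotOf ws
      vars≡ : concatMap slotVars slots ≡ concatMap slotVarsOf ws
      vars≡ = cong concat (sym (map-∘ ws))
      slot-unique : ∀ {w} → w ∈ ws → Unique (slotVarsOf w)
      slot-unique {w} w∈ with w Fin.≟ u
      ... | yes _ = [] ∷ []
      ... | no  _ = (edge≢edge (u≢x ∘ sym) (x≢ w∈) ∷ []) ∷ [] ∷ []
      slot-determined : ∀ {w w′ b} → w ∈ ws → w′ ∈ ws → b ∈ slotVarsOf w → b ∈ slotVarsOf w′ → w ≡ w′
      slot-determined w∈ w′∈ b∈ b∈′ with ∈-slotVars⁻ b∈ | ∈-slotVars⁻ b∈′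
      ... | inj₁ b≡       | inj₁ b≡′       = edge-injectiveʳ (trans (sym b≡) b≡′)
      ... | inj₁ b≡       | inj₂ (_ , b≡′) = ⊥-elim (edge≢edge (u≢x ∘ sym) (x≢ w′∈) (trans (sym b≡) b≡′))
      ... | inj₂ (_ , b≡) | inj₁ b≡′       = ⊥-elim (edge≢edge (u≢x ∘ sym) (x≢ w∈) (trans (sym b≡′) b≡))
      ... | inj₂ (_ , b≡) | inj₂ (_ , b≡′) = edge-injectiveʳ (trans (sym b≡) b≡′)
      slotVar∈upperPairs : ∀ {b} → b ∈ concatMap slotVarsOf ws → b ∈ upperPairs n
      slotVar∈upperPairs b∈ with find (∈-concatMap⁻ slotVarsOf b∈)
      ... | w , w∈ , b∈slot with ∈-slotVars⁻ b∈slot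
      ...   | inj₁ refl          = edge∈upperPairs (x≢ w∈)
      ...   | inj₂ (w≢u , refl) = edge∈upperPairs (w≢u ∘ sym)

-- The bipartite frame

module _ {n : ℕ} (k : ℕ) (k+k≤n : k + k ≤ n) where

  lowerVertex upperVertex : Fin k → Fin n
  lowerVertex i = Fin.inject≤ (i Fin.↑ˡ k) k+k≤n
  upperVertex i = Fin.inject≤ (k Fin.↑ʳ i) k+k≤n

  toℕ-lowerVertex : ∀ i → Fin.toℕ (lowerVertex i) ≡ Fin.toℕ i
  toℕ-lowerVertex i = trans (Fin.toℕ-inject≤ (i Fin.↑ˡ k) k+k≤n) (Fin.toℕ-↑ˡ i k)

  toℕ-upperVertex : ∀ i → Fin.toℕ (upperVertex i) ≡ k + Fin.toℕ i
  toℕ-upperVertex i = trans (Fin.toℕ-inject≤ (k Fin.↑ʳ i) k+k≤n) (Fin.toℕ-↑ʳ k i)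

  lowerHalf upperHalf : List (Fin n)
  lowerHalf = tabulate lowerVertex
  upperHalf = tabulate upperVertex

  lowerHalf-unique : Unique lowerHalf
  lowerHalf-unique = Unique.tabulate⁺ λ {i} {j} eq → Fin.toℕ-injective
    (trans (sym (toℕ-lowerVertex i)) (trans (cong Fin.toℕ eq) (toℕ-lowerVertex j)))

  upperHalf-unique : Unique upperHalf
  upperHalf-unique = Unique.tabulate⁺ λ {i} {j} eq → Fin.toℕ-injective (+-cancelˡ-≡ k _ _
    (trans (sym (toℕ-upperVertex i)) (trans (cong Fin.toℕ eq) (toℕ-upperVertex j))))

  length-lowerHalf : length lowerHalf ≡ k
  length-lowerHalf = length-tabulate lowerVertex

  length-upperHalf : length upperHalf ≡ k
  length-upperHalf = length-tabulate upperVertex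

  halves-disjoint : ∀ {x} → x ∈ lowerHalf → x ∉ upperHalf
  halves-disjoint x∈lower x∈upper with ∈-tabulate⁻ x∈lower | ∈-tabulate⁻ x∈upper
  ... | i , refl | j , eq = <⇒≱
    (subst (_< k) (sym (toℕ-lowerVertex i)) (Fin.toℕ<n i))
    (subst (k ≤_) (sym (trans (cong Fin.toℕ eq) (toℕ-upperVertex j))) (m≤m+n k (Fin.toℕ j)))

module BipartiteFrame {n : ℕ} (D : ℕ) (positive : 1 ≤ D) (room : 8 * D + 8 * D ≤ n) where
  open BooleanCube (_≟ₚ_ {n})
  open import Data.List.Membership.DecPropositional (Fin._≟_ {n}) using (_∈?_)

  A B : List (Fin n)
  A = lowerHalf (8 * D) room
  B = upperHalf (8 * D) room

  Core : Fin n → Set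
  Core x = x ∈ A ⊎ x ∈ B

  opposite : Fin n → List (Fin n)
  opposite x = if does (x ∈? A) then B else A

  record ValidOpposite (x : Fin n) (ws : List (Fin n)) : Set where
    field
      x∉opposite      : x ∉ ws
      opposite-unique : Unique ws
      opposite-length : length ws ≡ 8 * D
      opposite⊆core   : ∀ {s} → s ∈ ws → Core s

  validOpposite : ∀ {x} → Core x → ValidOpposite x (opposite x)
  validOpposite {x} core with x ∈? A | core
  ... | yes x∈A | _        = record { x∉opposite      = halves-disjoint (8 * D) room x∈A
                                    ; opposite-unique = upperHalf-unique (8 * D) room
                                    ; opposite-length = length-upperHalf (8 * D) room
                                    ; opposite⊆core   = inj₂ }
  ... | no  x∉A | inj₁ x∈A = ⊥-elim (x∉A x∈A)
  ... | no  x∉A | inj₂ _   = record { x∉opposite      = x∉A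
                                    ; opposite-unique = lowerHalf-unique (8 * D) room
                                    ; opposite-length = length-lowerHalf (8 * D) room
                                    ; opposite⊆core   = inj₁ }

  core⇒∈ : ∀ {x} → Core x → x ∈ A ++ B
  core⇒∈ (inj₁ x∈A) = ∈-++⁺ˡ x∈A
  core⇒∈ (inj₂ x∈B) = ∈-++⁺ʳ A x∈B

  others : Fin n → List (Fin n)
  others x = filter (λ u → ¬? (u Fin.≟ x)) (allFin n)

  rowEvents : Fin n → List Event
  rowEvents x = fewNeighbours D x (opposite x) ∷ map (λ u → covers D u x (opposite x)) (others x)

  bad : Event
  bad = anyOf (concatMap rowEvents (A ++ B))

  bad-rare : ∀ σ → 2 ^ D * count (upperPairs n) bad σ ≤ 16 * D * suc n * 2 ^ length (upperPairs n)
  bad-rare σ = ≤-trans (union-bound (upperPairs n) events σ {2 ^ D} event-rare) (*-monoˡ-≤ _ events-length)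
    where
    events = concatMap rowEvents (A ++ B)
    row-rare : ∀ {x e} → Core x → e ∈ rowEvents x → 2 ^ D * count (upperPairs n) e σ ≤ 2 ^ length (upperPairs n)
    row-rare core (here refl) = fewNeighbours-rare x∉opposite D σ opposite-unique opposite-length
      where open ValidOpposite (validOpposite core)
    row-rare {x} core (there e∈) with ∈-map⁻ (λ u → covers D u x (opposite x)) e∈
    ... | u , u∈ , refl = covers-rare x∉opposite D u σ u≢x opposite-unique
      where
      open ValidOpposite (validOpposite core)
      u≢x = proj₂ (∈-filter⁻ (λ u → ¬? (u Fin.≟ x)) {xs = allFin n} u∈)
    event-rare : ∀ {e} → e ∈ events → 2 ^ D * count (upperPairs n) e σ ≤ 2 ^ length (upperPairs n)
    event-rare e∈ = let x , x∈ , e∈row = find (∈-concatMap⁻ rowEvents e∈) in row-rare (∈-++⁻ A x∈) e∈row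
    row-length : ∀ x → length (rowEvents x) ≤ suc n
    row-length x = s≤s (begin
      length (map (λ u → covers D u x (opposite x)) (others x)) ≡⟨ length-map _ (others x) ⟩
      length (others x)                                         ≤⟨ length-filter (λ u → ¬? (u Fin.≟ x)) (allFin n) ⟩
      length (allFin n)                                         ≡⟨ length-tabulate _ ⟩
      n ∎)
      where open ≤-Reasoning
    events-length : length events ≤ 16 * D * suc n
    events-length = begin
      length events             ≤⟨ length-concatMap-≤ rowEvents (A ++ B) row-length ⟩
      length (A ++ B) * suc n   ≡⟨ cong (_* suc n) (trans (length-++ A) (cong₂ _+_ (length-lowerHalf (8 * D) room)
                                                                                  (length-upperHalf (8 * D) room))) ⟩
      (8 * D + 8 * D) * suc n   ≡⟨ cong (_* suc n) (16D D) ⟩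
      16 * D * suc n ∎
      where
      open ≤-Reasoning
      16D : ∀ D → 8 * D + 8 * D ≡ 16 * D
      16D = solve-∀

  module _ (σ : Pair n → Bool) (good : bad σ ≡ false) where

    private
      G = toGraph σ

    row-false : ∀ {x} → Core x → ∀ {e} → e ∈ rowEvents x → e σ ≡ false
    row-false core e∈ = anyOf-false (concatMap rowEvents (A ++ B)) σ good
      (∈-concat⁺′ e∈ (∈-map⁺ rowEvents (core⇒∈ core)))

    neighbours : Fin n → List (Fin n)
    neighbours x = takeFirst D (σ ∘ edge x) (opposite x)

    neighbours-length : ∀ {x} → Core x → length (neighbours x) ≡ D
    neighbours-length {x} core =
      fewerThan-false⇒length-takeFirst D (edge x) (opposite x) σ (row-false core (here refl))

    neighbours-adjacent : ∀ {x s} → Core x → s ∈ neighbours x → Adj G x s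
    neighbours-adjacent {x} core s∈ with ∈-takeFirst⁻ D (σ ∘ edge x) (opposite x) s∈
    ... | s∈opp , σxs = edge⇒adjacent σ (λ x≡s → x∉opposite (subst (_∈ opposite x) (sym x≡s) s∈opp)) σxs
      where open ValidOpposite (validOpposite core)

    neighbours-core : ∀ {x s} → Core x → s ∈ neighbours x → Core s
    neighbours-core {x} core s∈ = opposite⊆core (proj₁ (∈-takeFirst⁻ D (σ ∘ edge x) (opposite x) s∈))
      where open ValidOpposite (validOpposite core)

    neighbours-determine : ∀ {x} → Core x → ∀ u → (∀ {s} → s ∈ neighbours x → Adj G u s) → u ≡ x
    neighbours-determine {x} core u adjacent with u Fin.≟ x
    ... | yes u≡x = u≡x
    ... | no  u≢x = ⊥-elim (true≢false (trans (sym covered) uncovered))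
      where
      covered : covers D u x (opposite x) σ ≡ true
      covered = takeFirst⇒firstPartnered D (edge x) (partnerOf u) (opposite x) σ (neighbours-length core) λ s∈ →
        let u~s = adjacent s∈
            s≢u = λ s≡u → Adj-irreflexive G u (subst (Adj G u) s≡u u~s)
        in edge u _ , partnerOf-≢ s≢u , adjacent⇒edge σ u~s
      uncovered : covers D u x (opposite x) σ ≡ false
      uncovered = row-false core (there (∈-map⁺ (λ u → covers D u x (opposite x))
                                               (∈-filter⁺ (λ u → ¬? (u Fin.≟ x)) (∈-allFin u) u≢x)))

    frame : ∀ d → D ≤ d → RigidFrame G d
    frame d D≤d = record
      { Core               = Core
      ; child              = child
      ; root               = lowerVertex (8 * D) room first
      ; other              = upperVertex (8 * D) room first
      ; root-core          = inj₁ (∈-tabulate⁺ first)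
      ; other≢root         = λ eq → halves-disjoint (8 * D) room (∈-tabulate⁺ first)
                                                    (subst (_∈ B) eq (∈-tabulate⁺ first))
      ; child-adjacent     = λ core c → neighbours-adjacent core (child∈ core c)
      ; child-core         = λ core c → neighbours-core core (child∈ core c)
      ; children-determine = λ core u adjacent → neighbours-determine core u λ s∈ →
                               let c , child≡s = children-onto core s∈ in subst (Adj G u) child≡s (adjacent c)
      }
      where
      first : Fin (8 * D)
      first = Fin.fromℕ< (≤-trans (s≤s z≤n) (*-monoʳ-≤ 8 positive))
      child : Fin n → Fin d → Fin n
      child x c = lookupClamped x (neighbours x) (Fin.toℕ c)
      child∈ : ∀ {x} → Core x → ∀ c → child x c ∈ neighbours x
      child∈ {x} core c = lookupClamped-∈ x (neighbours x) (Fin.toℕ c)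
                            (subst (1 ≤_) (sym (neighbours-length core)) positive)
      children-onto : ∀ {x s} → Core x → s ∈ neighbours x → ∃[ c ] child x c ≡ s
      children-onto {x} core s∈ with lookupClamped-surjective x (neighbours x) s∈
      ... | i , i<length , lookup≡s = Fin.fromℕ< i<d ,
            trans (cong (lookupClamped x (neighbours x)) (Fin.toℕ-fromℕ< i<d)) lookup≡s
        where
        i<d : i < d
        i<d = ≤-trans i<length (≤-trans (≤-reflexive (neighbours-length core)) D≤d)

-- Choosing the depth

dyadic-interval : ∀ n → 1 ≤ n → ∃[ ℓ ] 2 ^ ℓ ≤ n × n < 2 ^ suc ℓ
dyadic-interval (suc zero)    _ = 0 , s≤s z≤n , s≤s (s≤s z≤n)
dyadic-interval (suc (suc m)) _ with dyadic-interval (suc m) (s≤s z≤n)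
... | ℓ , lower , upper with suc (suc m) <? 2 ^ suc ℓ
...   | yes below = ℓ , ≤-trans lower (n≤1+n _) , below
...   | no  ≮     = suc ℓ , ≤-reflexive reached ,
                    subst (_< 2 ^ suc (suc ℓ)) reached (^-monoʳ-< 2 (s≤s (s≤s z≤n)) (n<1+n (suc ℓ)))
  where
  reached : 2 ^ suc ℓ ≡ suc (suc m)
  reached = ≤-antisym (≮⇒≥ ≮) upper

square≤exponential : ∀ j → (j + 4) * (j + 4) ≤ 2 ^ (j + 4)
square≤exponential zero    = ≤-refl
square≤exponential (suc j) = begin
  (suc j + 4) * (suc j + 4)        ≡⟨ expand j ⟩
  (j + 4) * (j + 4) + (2 * j + 9)  ≤⟨ +-monoʳ-≤ ((j + 4) * (j + 4)) (m≤m+n (2 * j + 9) (j * j + 6 * j + 7)) ⟩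
  (j + 4) * (j + 4) + (2 * j + 9 + (j * j + 6 * j + 7)) ≡⟨ cong ((j + 4) * (j + 4) +_) (square j) ⟩
  (j + 4) * (j + 4) + (j + 4) * (j + 4) ≤⟨ +-mono-≤ (square≤exponential j) (square≤exponential j) ⟩
  2 ^ (j + 4) + 2 ^ (j + 4)        ≡⟨ 2^-double (j + 4) ⟩
  2 ^ suc (j + 4) ∎
  where
  open ≤-Reasoning
  expand : ∀ j → (suc j + 4) * (suc j + 4) ≡ (j + 4) * (j + 4) + (2 * j + 9)
  expand = solve-∀
  square : ∀ j → 2 * j + 9 + (j * j + 6 * j + 7) ≡ (j + 4) * (j + 4)
  square = solve-∀

linear≤exponential : ∀ m t → m + 4 ≤ t → m * suc t ≤ 2 ^ t
linear≤exponential m t m+4≤t = begin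
  m * suc t               ≡⟨ *-suc m t ⟩
  m + m * t               ≤⟨ +-monoˡ-≤ (m * t) (<⇒≤ m<t) ⟩
  suc m * t               ≤⟨ *-monoˡ-≤ t m<t ⟩
  t * t                   ≡⟨ cong (λ s → s * s) (sym t≡) ⟩
  (t ∸ 4 + 4) * (t ∸ 4 + 4) ≤⟨ square≤exponential (t ∸ 4) ⟩
  2 ^ (t ∸ 4 + 4)          ≡⟨ cong (2 ^_) t≡ ⟩
  2 ^ t ∎
  where
  open ≤-Reasoning
  m<t : m < t
  m<t = ≤-trans (m≤m+n (suc m) 3) (subst (_≤ t) (+-suc m 3) m+4≤t)
  t≡ : t ∸ 4 + 4 ≡ t
  t≡ = m∸n+n≡m (≤-trans (m≤n+m 4 m) m+4≤t)

-- The depth D = ℓ + ⌊ℓ / (b+1)⌋, where 2 ^ ℓ ≤ n < 2 ^ (ℓ+1), beats the n log n bad events by a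
-- factor 2 ^ ⌊ℓ / (b+1)⌋ while keeping D (b+1) ≤ ℓ (b+2).
module Depth (a b q : ℕ) where

  private
    B c m T : ℕ
    B = suc b
    c = suc q * 16
    m = 2 * c * suc B
    T = m + 4

  module Bounds (n ℓ : ℕ) (2^ℓ≤n : 2 ^ ℓ ≤ n) (n<2^ℓ⁺¹ : n < 2 ^ suc ℓ) (ℓ-large : suc T * B ≤ ℓ) where

    private
      t D : ℕ
      t = ℓ / B
      D = ℓ + t

      t-large : suc T ≤ t
      t-large = subst (_≤ t) (m*n/n≡m (suc T) B) (/-monoˡ-≤ B ℓ-large)

      tB≤ℓ : t * B ≤ ℓ
      tB≤ℓ = m/n*n≤m ℓ B

      t≤ℓ : t ≤ ℓ
      t≤ℓ = ≤-trans (m≤m*n t B) tB≤ℓ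

      ℓ<[1+t]B : ℓ < suc t * B
      ℓ<[1+t]B = begin-strict
        ℓ               ≡⟨ m≡m%n+[m/n]*n ℓ B ⟩
        ℓ % B + t * B   <⟨ +-monoˡ-< (t * B) (m%n<n ℓ B) ⟩
        B + t * B       ∎
        where open ≤-Reasoning

      2cD≤2^t : 2 * c * D ≤ 2 ^ t
      2cD≤2^t = begin
        2 * c * (ℓ + t)               ≤⟨ *-monoʳ-≤ (2 * c) (+-mono-≤ (<⇒≤ ℓ<[1+t]B) (n≤1+n t)) ⟩
        2 * c * (suc t * B + suc t)   ≡⟨ regroup c t B ⟩
        m * suc t                     ≤⟨ linear≤exponential m t (≤-trans (n≤1+n T) t-large) ⟩
        2 ^ t ∎
        where
        open ≤-Reasoning
        regroup : ∀ c t B → 2 * c * (suc t * B + suc t) ≡ 2 * c * suc B * suc t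
        regroup = solve-∀

    depth-positive : 1 ≤ D
    depth-positive = ≤-trans (≤-trans (s≤s z≤n) t-large) (m≤n+m t ℓ)

    depth-room : 8 * D + 8 * D ≤ n
    depth-room = begin
      8 * D + 8 * D       ≡⟨ sixteen D ⟩
      16 * D              ≤⟨ *-monoˡ-≤ D (m≤n*m 16 (2 * suc q)) ⟩
      2 * suc q * 16 * D  ≡⟨ cong (_* D) (*-assoc 2 (suc q) 16) ⟩
      2 * c * D           ≤⟨ 2cD≤2^t ⟩
      2 ^ t               ≤⟨ ^-monoʳ-≤ 2 t≤ℓ ⟩
      2 ^ ℓ               ≤⟨ 2^ℓ≤n ⟩
      n ∎
      where
      open ≤-Reasoning
      sixteen : ∀ D → 8 * D + 8 * D ≡ 16 * D
      sixteen = solve-∀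

    depth-union : suc q * (16 * D * suc n) ≤ 2 ^ D
    depth-union = begin
      suc q * (16 * D * suc n)  ≡⟨ regroup (suc q) D (suc n) ⟩
      c * D * suc n             ≤⟨ *-monoʳ-≤ (c * D) n<2^ℓ⁺¹ ⟩
      c * D * 2 ^ suc ℓ         ≡⟨ double c D (2 ^ ℓ) ⟩
      2 * c * D * 2 ^ ℓ         ≤⟨ *-monoˡ-≤ (2 ^ ℓ) 2cD≤2^t ⟩
      2 ^ t * 2 ^ ℓ             ≡⟨ sym (^-distribˡ-+-* 2 t ℓ) ⟩
      2 ^ (t + ℓ)               ≡⟨ cong (2 ^_) (+-comm t ℓ) ⟩
      2 ^ D ∎
      where
      open ≤-Reasoning
      regroup : ∀ q D n → q * (16 * D * n) ≡ q * 16 * D * n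
      regroup = solve-∀
      double : ∀ c D y → c * D * (2 * y) ≡ 2 * c * D * y
      double = solve-∀

    depth-exponent : 2 ^ (D * B) ≤ n ^ (suc a + B)
    depth-exponent = begin
      2 ^ (D * B)             ≤⟨ ^-monoʳ-≤ 2 D*B≤ ⟩
      2 ^ (ℓ * (suc a + B))   ≡⟨ sym (^-*-assoc 2 ℓ (suc a + B)) ⟩
      (2 ^ ℓ) ^ (suc a + B)   ≤⟨ ^-monoˡ-≤ (suc a + B) 2^ℓ≤n ⟩
      n ^ (suc a + B) ∎
      where
      open ≤-Reasoning
      D*B≤ : D * B ≤ ℓ * (suc a + B)
      D*B≤ = begin
        (ℓ + t) * B           ≡⟨ *-distribʳ-+ B ℓ t ⟩
        ℓ * B + t * B         ≤⟨ +-monoʳ-≤ (ℓ * B) (≤-trans tB≤ℓ (m≤m*n ℓ (suc a))) ⟩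
        ℓ * B + ℓ * suc a     ≡⟨ sym (*-distribˡ-+ ℓ B (suc a)) ⟩
        ℓ * (B + suc a)       ≡⟨ cong (ℓ *_) (+-comm B (suc a)) ⟩
        ℓ * (suc a + B) ∎

  goodDepth : ∃[ N ] ∀ n → N ≤ n → ∃[ D ]
    1 ≤ D × 8 * D + 8 * D ≤ n × suc q * (16 * D * suc n) ≤ 2 ^ D × 2 ^ (D * suc b) ≤ n ^ (suc a + suc b)
  goodDepth = 2 ^ (suc T * B) , λ n N≤n →
    let ℓ , 2^ℓ≤n , n<2^ℓ⁺¹ = dyadic-interval n (≤-trans (m^n>0 2 (suc T * B)) N≤n)
        ℓ-large = ≮⇒≥ λ ℓ<sTB → <⇒≱ n<2^ℓ⁺¹ (≤-trans (^-monoʳ-≤ 2 ℓ<sTB) N≤n)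
        module D = Bounds n ℓ 2^ℓ≤n n<2^ℓ⁺¹ ℓ-large
    in ℓ + ℓ / B , D.depth-positive , D.depth-room , D.depth-union , D.depth-exponent

warmthBound-whp : ∀ {n} a b q D → 1 ≤ D → 8 * D + 8 * D ≤ n → suc q * (16 * D * suc n) ≤ 2 ^ D →
                  2 ^ (D * b) ≤ n ^ (a + b) → ProbAtLeast1-1/ (suc q) n (WarmthBound a b)
warmthBound-whp {n} a b q D positive room union exponent =
  probAtLeast-fromBad (suc q) (WarmthBound a b) bad
    (λ σ good → rigidFrames⇒warmthBound a b D (frame σ good) exponent)
    (subst (suc q * count (upperPairs n) bad σ₀ ≤_) (cong (2 ^_) (length-upperPairs n))
      (*-cancelˡ-≤ (2 ^ D) {{m^n≢0 2 D}} (begin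
        2 ^ D * (suc q * count (upperPairs n) bad σ₀)  ≡⟨ x*[y*z]≡y*[x*z] (2 ^ D) (suc q) _ ⟩
        suc q * (2 ^ D * count (upperPairs n) bad σ₀)  ≤⟨ *-monoʳ-≤ (suc q) (bad-rare σ₀) ⟩
        suc q * (16 * D * suc n * P)                   ≡⟨ sym (*-assoc (suc q) (16 * D * suc n) P) ⟩
        suc q * (16 * D * suc n) * P                   ≤⟨ *-monoˡ-≤ P union ⟩
        2 ^ D * P ∎)))
  where
  open BooleanCube (_≟ₚ_ {n})
  open BipartiteFrame D positive room
  open ≤-Reasoning
  P = 2 ^ length (upperPairs n)
  σ₀ : Assignment
  σ₀ _ = false
  x*[y*z]≡y*[x*z] : ∀ x y z → x * (y * z) ≡ y * (x * z)
  x*[y*z]≡y*[x*z] = solve-∀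

theorem3p2 : ∀ (a b : ℕ) → (q : ℕ) →
    ∃[ N ] ∀ (n : ℕ) → n ≥ N →
      ProbAtLeast1-1/ (suc q) n (WarmthBound (suc a) (suc b))
theorem3p2 a b q =
  let N , choose = Depth.goodDepth a b q in
  N , λ n N≤n →
    let D , positive , room , union , exponent = choose n N≤n in
    warmthBound-whp (suc a) (suc b) q D positive room union exponent
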